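{- Let $(F_n)_{n\ge0}$ be the Fibonacci numbers ($F_0=0$, $F_1=1$, $F_{n+2}=F_{n+1}+F_n$) and $(L_n)_{n\ge0}$ the Lucas numbers ($L_0=2$, $L_1=1$, $L_{n+2}=L_{n+1}+L_n$). Let $F = \{F_n : n \geq 1\}$, $L = \{L_n : n\geq 1\}$, and for a set $X$ of positive integers let $R(X) = \{x/y : x,y\in X\}$. (a) $R(F)$ is dense in $\mathbb{Q}_p$ for every prime $p$. (b) For a prime $p$, $R(L)$ is dense in $\mathbb{Q}_p$ if and only if $p \neq 2$ and $p \mid L_n$ for some $n \geq 1$.
   Context: $\mathbb{Q}_p$ denotes the field of $p$-adic numbers with the $p$-adic metric. -}

module Defs where

open import Data.Nat as ℕ using (ℕ; zero; suc; _+_; _^_; NonZero)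
open import Data.Nat.Divisibility using (_∣_)
open import Data.Integer as ℤ using (ℤ; +_)
open import Data.Rational as ℚ using (ℚ; _/_; ↥_; ↧ₙ_; _-_)
open import Data.Product using (Σ; ∃; _×_; _,_)
open import Relation.Nullary using (¬_)
open import Relation.Binary.PropositionalEquality using (_≡_)

fib : ℕ → ℕ
fib zero = 0
fib (suc zero) = 1
fib (suc (suc n)) = fib (suc n) + fib n

lucas : ℕ → ℕ
lucas zero = 2
lucas (suc zero) = 1
lucas (suc (suc n)) = lucas (suc n) + lucas n

private
  nz+ : ∀ m n → NonZero m → NonZero (m + n)
  nz+ (suc m) n _ = _

fib-nz : ∀ n → NonZero (fib (suc n))
fib-nz zero = _
fib-nz (suc n) = nz+ (fib (suc n)) (fib n) (fib-nz n)

lucas-nz : ∀ n → NonZero (lucas (suc n))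
lucas-nz zero = _
lucas-nz (suc n) = nz+ (lucas (suc n)) (lucas n) (lucas-nz n)

-- A set X ⊆ ℤ_{>0} given as a sequence s with s (suc n) ≠ 0 ; indexing from n ≥ 1.
-- R(F) = { F_m / F_n : m, n ≥ 1 }
inRF : ℚ → Set
inRF r = ∃ λ m → ∃ λ n → r ≡ ((+ fib (suc m)) / fib (suc n)) {{fib-nz n}}

inRL : ℚ → Set
inRL r = ∃ λ m → ∃ λ n → r ≡ ((+ lucas (suc m)) / lucas (suc n)) {{lucas-nz n}}

-- |r|_p ≤ p^(-k), for r a rational in lowest terms n/d (d > 0):
-- v_p(n) - v_p(d) ≥ k.  For k ≥ 1 and any k with r = 0 this is exactly
-- p^k ∣ n and p ∤ d (using gcd(n,d) = 1); for k = 0 it is p ∤ d.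
pSmall : ℕ → ℕ → ℚ → Set
pSmall p k r = (p ^ k ∣ ℤ.∣ ↥ r ∣) × ¬ (p ∣ ↧ₙ r)

-- A set S ⊆ ℚ is dense in ℚ_p.  Since ℚ is dense in ℚ_p and the balls
-- {x : |x - q|_p ≤ p^(-k)} form a base, this says: every such ball around a
-- rational centre q meets S.
DenseInQp : ℕ → (ℚ → Set) → Set
DenseInQp p S = ∀ (q : ℚ) (k : ℕ) → ∃ λ r → S r × pSmall p k (r - q)

-- Say that s has cofactors covering the residues modulo P if some f satisfies: every class
-- c mod P contains a G with f · G a term of s. If this holds modulo every power of p, the
-- quotient set of s is dense in ℚ_p: for q = c/d with p^e ∥ d choose such cofactors A ≡ c and
-- B ≡ d modulo p^K, K large; then f·A / f·B = A/B, p^e ∥ B, and A/B − q = (Ad − cB)/(Bd) has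
-- p-adic valuation at least K − 2e.
--
-- Fibonacci: by pigeonhole on consecutive pairs, F(n) ≡ 0 and F(n+1) ≡ 1 (mod P) for some
-- n ≥ 1, and then the addition formula gives F(jn) = F(n)·G with G ≡ j.
-- Lucas: if P is odd and P ∣ L(m), then L((2i+1)m) = L(m)·G with G ≡ (2i+1)·Λ^i, where
-- Λ = F(2m+1) ≡ ±1 by Cassini's identity. Even i give every residue, and 2i+1 = p turns
-- p^k ∣ L(m) into p^(k+1) ∣ L(pm). Conversely, density near 0 forces p^k ∣ L(m) for all k,
-- which fails for p = 2 since 8 divides no Lucas number: L(n+6) = 8·L(n+1) + 5·L(n).

module Submission where

open import Defs
open import Data.Nat using (ℕ; suc)
open import Data.Nat.Primality using (Prime)
open import Data.Nat.Divisibility using (_∣_)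
open import Data.Product using (_×_; ∃)
open import Function.Bundles using (_⇔_)
open import Relation.Binary.PropositionalEquality using (_≢_)

open import Data.Nat as ℕ using (zero; _+_; _*_; _^_; _<_; NonZero; s≤s)
import Data.Nat.Properties as ℕ
open import Data.Nat.DivMod using (_%_; _/_; m≡m%n+[m/n]*n; m%n<n)
open import Data.Nat.Divisibility
  using (_∣?_; divides; ∣-refl; ∣-trans; m∣m*n; n∣m*n; ∣m⇒∣m*n; ∣n⇒∣m*n;
         ∣m+n∣m⇒∣n; *-monoʳ-∣; *-monoˡ-∣; *-cancelˡ-∣; 1∣_)
open import Data.Nat.Primality
  using (euclidsLemma; prime⇒irreducible; prime⇒nonZero; prime⇒nonTrivial; ¬prime[1])
open import Data.Nat.Coprimality using (Coprime; recompute; coprime?; coprime-divisor)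
open import Data.Nat.Induction using (<-wellFounded)
open import Data.Nat.Tactic.RingSolver using () renaming (solve-∀ to ℕ-solve-∀)
open import Data.Integer as ℤ using (ℤ; +_)
import Data.Integer.Properties as ℤ
open import Data.Integer.DivMod using (_%ℕ_; _/ℕ_; a≡a%ℕn+[a/ℕn]*n; n%ℕd<d)
import Data.Integer.Divisibility.Signed as ℤ∣
open import Data.Integer.Tactic.RingSolver using () renaming (solve-∀ to ℤ-solve-∀)
open import Data.Rational as ℚ using (ℚ; mkℚ; ↥_; ↧_; ↧ₙ_)
import Data.Rational.Properties as ℚ
open import Data.Rational.Unnormalised as ℚᵘ using (mkℚᵘ; *≡*)
import Data.Rational.Unnormalised.Properties as ℚᵘ
open import Data.Fin as Fin using (Fin; toℕ; fromℕ<; combine)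
import Data.Fin.Properties as Fin
open import Data.Empty using (⊥-elim)
open import Data.Sum using (inj₁; inj₂; [_,_]′)
open import Data.Product using (_,_; proj₁; proj₂; uncurry)
open import Function using (_∘_; mk⇔)
open import Induction.WellFounded using (Acc; acc)
open import Relation.Nullary using (¬_; yes; no)
open import Relation.Nullary.Decidable using (from-yes; from-no)
open import Relation.Binary.Bundles using (Setoid)
import Relation.Binary.Reasoning.Setoid as SetoidReasoning
open import Relation.Binary.PropositionalEquality
  using (_≡_; refl; sym; trans; cong; cong₂; subst; subst₂; module ≡-Reasoning)

-- A record, not a definition, so that x, y and P can be recovered by unification.
infix 4 _≡_mod_
record _≡_mod_ (x y : ℤ) (P : ℕ) : Set where
  constructor ∣-diff
  field modulus∣diff : + P ℤ∣.∣ x ℤ.- y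

private
  ∣-resp : ∀ {k a b} → a ≡ b → k ℤ∣.∣ a → k ℤ∣.∣ b
  ∣-resp {k} = subst (k ℤ∣.∣_)

module _ {P : ℕ} where

  ≡⇒≡-mod : ∀ {x y} → x ≡ y → x ≡ y mod P
  ≡⇒≡-mod {x} refl =
    ∣-diff (ℤ∣.divides (+ 0) (trans (ℤ.+-inverseʳ x) (sym (ℤ.*-zeroˡ (+ P)))))

  ≡-mod-refl : ∀ {x} → x ≡ x mod P
  ≡-mod-refl = ≡⇒≡-mod refl

  ≡-mod-sym : ∀ {x y} → x ≡ y mod P → y ≡ x mod P
  ≡-mod-sym {x} {y} (∣-diff h) = ∣-diff (∣-resp (e x y) (ℤ∣.∣m⇒∣-m h))
    where e : ∀ x y → ℤ.- (x ℤ.- y) ≡ y ℤ.- x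
          e = ℤ-solve-∀

  ≡-mod-trans : ∀ {x y z} → x ≡ y mod P → y ≡ z mod P → x ≡ z mod P
  ≡-mod-trans {x} {y} {z} (∣-diff h) (∣-diff h′) =
    ∣-diff (∣-resp (e x y z) (ℤ∣.∣m∣n⇒∣m+n h h′))
    where e : ∀ x y z → (x ℤ.- y) ℤ.+ (y ℤ.- z) ≡ x ℤ.- z
          e = ℤ-solve-∀

  +-cong-mod : ∀ {x x′ y y′} → x ≡ x′ mod P → y ≡ y′ mod P →
               x ℤ.+ y ≡ x′ ℤ.+ y′ mod P
  +-cong-mod {x} {x′} {y} {y′} (∣-diff h) (∣-diff h′) =
    ∣-diff (∣-resp (e x x′ y y′) (ℤ∣.∣m∣n⇒∣m+n h h′))
    where e : ∀ x x′ y y′ → (x ℤ.- x′) ℤ.+ (y ℤ.- y′) ≡ (x ℤ.+ y) ℤ.- (x′ ℤ.+ y′)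
          e = ℤ-solve-∀

  -‿cong-mod : ∀ {x x′} → x ≡ x′ mod P → ℤ.- x ≡ ℤ.- x′ mod P
  -‿cong-mod {x} {x′} (∣-diff h) = ∣-diff (∣-resp (e x x′) (ℤ∣.∣m⇒∣-m h))
    where e : ∀ x x′ → ℤ.- (x ℤ.- x′) ≡ (ℤ.- x) ℤ.- (ℤ.- x′)
          e = ℤ-solve-∀

  -‿cong₂-mod : ∀ {x x′ y y′} → x ≡ x′ mod P → y ≡ y′ mod P →
                x ℤ.- y ≡ x′ ℤ.- y′ mod P
  -‿cong₂-mod h h′ = +-cong-mod h (-‿cong-mod h′)

  *-cong-mod : ∀ {x x′ y y′} → x ≡ x′ mod P → y ≡ y′ mod P →
               x ℤ.* y ≡ x′ ℤ.* y′ mod P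
  *-cong-mod {x} {x′} {y} {y′} (∣-diff h) (∣-diff h′) =
    ∣-diff (∣-resp (e x x′ y y′)
                    (ℤ∣.∣m∣n⇒∣m+n (ℤ∣.∣n⇒∣m*n x h′) (ℤ∣.∣m⇒∣m*n y′ h)))
    where e : ∀ x x′ y y′ →
              x ℤ.* (y ℤ.- y′) ℤ.+ (x ℤ.- x′) ℤ.* y′ ≡ x ℤ.* y ℤ.- x′ ℤ.* y′
          e = ℤ-solve-∀

  +-congˡ-mod : ∀ x {y y′} → y ≡ y′ mod P → x ℤ.+ y ≡ x ℤ.+ y′ mod P
  +-congˡ-mod x = +-cong-mod (≡-mod-refl {x})

  +-congʳ-mod : ∀ y {x x′} → x ≡ x′ mod P → x ℤ.+ y ≡ x′ ℤ.+ y mod P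
  +-congʳ-mod y x≡x′ = +-cong-mod x≡x′ (≡-mod-refl {y})

  *-congˡ-mod : ∀ x {y y′} → y ≡ y′ mod P → x ℤ.* y ≡ x ℤ.* y′ mod P
  *-congˡ-mod x = *-cong-mod (≡-mod-refl {x})

  *-congʳ-mod : ∀ y {x x′} → x ≡ x′ mod P → x ℤ.* y ≡ x′ ℤ.* y mod P
  *-congʳ-mod y x≡x′ = *-cong-mod x≡x′ (≡-mod-refl {y})

  ∣⇒≡0-mod : ∀ {x} → + P ℤ∣.∣ x → x ≡ + 0 mod P
  ∣⇒≡0-mod {x} h = ∣-diff (∣-resp (sym (ℤ.+-identityʳ x)) h)

  ≡0-mod⇒∣ : ∀ {x} → x ≡ + 0 mod P → + P ℤ∣.∣ x
  ≡0-mod⇒∣ {x} (∣-diff h) = ∣-resp (ℤ.+-identityʳ x) h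

  ℕ∣⇒≡0-mod : ∀ {n} → P ∣ n → + n ≡ + 0 mod P
  ℕ∣⇒≡0-mod h = ∣⇒≡0-mod (ℤ∣.∣ᵤ⇒∣ h)

  ≡0-mod⇒∣-abs : ∀ {x} → x ≡ + 0 mod P → P ∣ ℤ.∣ x ∣
  ≡0-mod⇒∣-abs h = ℤ∣.∣⇒∣ᵤ (≡0-mod⇒∣ h)

  *-modulus≡0-mod : ∀ x → x ℤ.* + P ≡ + 0 mod P
  *-modulus≡0-mod x = ∣⇒≡0-mod (ℤ∣.divides x refl)

  ≡-mod-%ℕ : .{{_ : NonZero P}} → ∀ x → x ≡ + (x %ℕ P) mod P
  ≡-mod-%ℕ x = ∣-diff (ℤ∣.divides (x /ℕ P)
    (trans (cong (ℤ._- + (x %ℕ P)) (a≡a%ℕn+[a/ℕn]*n x P)) (e (+ (x %ℕ P)) (x /ℕ P) (+ P))))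
    where e : ∀ r q n → (r ℤ.+ q ℤ.* n) ℤ.- r ≡ q ℤ.* n
          e = ℤ-solve-∀

≡-mod-weaken : ∀ {P Q x y} → Q ∣ P → x ≡ y mod P → x ≡ y mod Q
≡-mod-weaken Q∣P (∣-diff h) = ∣-diff (ℤ∣.∣-trans (ℤ∣.∣ᵤ⇒∣ Q∣P) h)

∣-cong-mod : ∀ {P Q a b} → Q ∣ P → + a ≡ + b mod P → Q ∣ b → Q ∣ a
∣-cong-mod Q∣P a≡b Q∣b =
  ≡0-mod⇒∣-abs (≡-mod-trans (≡-mod-weaken Q∣P a≡b) (ℕ∣⇒≡0-mod Q∣b))

≡-mod-setoid : ℕ → Setoid _ _
≡-mod-setoid P = record
  { Carrier       = ℤ
  ; _≈_           = λ x y → x ≡ y mod P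
  ; isEquivalence = record { refl = ≡-mod-refl ; sym = ≡-mod-sym ; trans = ≡-mod-trans }
  }

module ≡-mod-Reasoning (P : ℕ) = SetoidReasoning (≡-mod-setoid P)

^-cong-mod : ∀ {P x y} n → x ≡ y mod P → x ℤ.^ n ≡ y ℤ.^ n mod P
^-cong-mod zero    _   = ≡-mod-refl
^-cong-mod (suc n) x≡y = *-cong-mod x≡y (^-cong-mod n x≡y)

^-even≡1-mod : ∀ {P x} → x ℤ.* x ≡ + 1 mod P → ∀ a → x ℤ.^ (2 * a) ≡ + 1 mod P
^-even≡1-mod {P} {x} x²≡1 a = begin
  x ℤ.^ (2 * a)        ≡⟨ ℤ.^-*-assoc x 2 a ⟨
  (x ℤ.^ 2) ℤ.^ a      ≡⟨ cong (λ y → (x ℤ.* y) ℤ.^ a) (ℤ.*-identityʳ x) ⟩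
  (x ℤ.* x) ℤ.^ a      ≈⟨ ^-cong-mod a x²≡1 ⟩
  (+ 1) ℤ.^ a          ≡⟨ ℤ.^-zeroˡ a ⟩
  + 1                  ∎
  where open ≡-mod-Reasoning P

record FibLike (W : ℕ → ℕ) : Set where
  constructor fibLike
  field recurrence : ∀ n → W (suc (suc n)) ≡ W (suc n) + W n

fib-fibLike : FibLike fib
fib-fibLike = fibLike λ _ → refl

lucas-fibLike : FibLike lucas
lucas-fibLike = fibLike λ _ → refl

fibLike-+ : ∀ {W} → FibLike W → ∀ x b →
            W (suc (x + b)) ≡ W (suc x) * fib (suc b) + W x * fib b
fibLike-+ {W} _ x zero = trans (cong (W ∘ suc) (ℕ.+-identityʳ x)) (e (W (suc x)) (W x))
  where e : ∀ a c → a ≡ a * 1 + c * 0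
        e = ℕ-solve-∀
fibLike-+ {W} W-rec x (suc b) = begin
  W (suc (x + suc b))
    ≡⟨ cong (W ∘ suc) (ℕ.+-suc x b) ⟩
  W (suc (suc x + b))
    ≡⟨ fibLike-+ W-rec (suc x) b ⟩
  W (suc (suc x)) * fib (suc b) + W (suc x) * fib b
    ≡⟨ cong (λ t → t * fib (suc b) + W (suc x) * fib b) (FibLike.recurrence W-rec x) ⟩
  (W (suc x) + W x) * fib (suc b) + W (suc x) * fib b
    ≡⟨ e (W (suc x)) (W x) (fib (suc b)) (fib b) ⟩
  W (suc x) * fib (suc (suc b)) + W x * fib (suc b) ∎
  where
    open ≡-Reasoning
    e : ∀ a c u v → (a + c) * u + a * v ≡ a * (u + v) + c * u
    e = ℕ-solve-∀

lucas≡fib+2fib : ∀ b → lucas (suc b) ≡ fib (suc b) + 2 * fib b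
lucas≡fib+2fib b =
  trans (fibLike-+ lucas-fibLike 0 b) (cong (_+ 2 * fib b) (ℕ.*-identityˡ (fib (suc b))))

pos-*+* : ∀ a b c d → + (a * b + c * d) ≡ + a ℤ.* + b ℤ.+ + c ℤ.* + d
pos-*+* a b c d = trans (ℤ.pos-+ (a * b) (c * d)) (cong₂ ℤ._+_ (ℤ.pos-* a b) (ℤ.pos-* c d))

pos-+* : ∀ a b c → + (a + b * c) ≡ + a ℤ.+ + b ℤ.* + c
pos-+* a b c = trans (ℤ.pos-+ a (b * c)) (cong (ℤ._+_ (+ a)) (ℤ.pos-* b c))

pos-fibLike-+ : ∀ {W} → FibLike W → ∀ x b →
                + W (suc (x + b)) ≡ + W (suc x) ℤ.* + fib (suc b) ℤ.+ + W x ℤ.* + fib b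
pos-fibLike-+ {W} W-rec x b =
  trans (cong +_ (fibLike-+ W-rec x b)) (pos-*+* (W (suc x)) (fib (suc b)) (W x) (fib b))

pos-fibLike : ∀ {W} → FibLike W → ∀ n → + W (suc (suc n)) ≡ + W (suc n) ℤ.+ + W n
pos-fibLike {W} W-rec n = trans (cong +_ (FibLike.recurrence W-rec n)) (ℤ.pos-+ (W (suc n)) (W n))

pos-fibLike-pred : ∀ {W} → FibLike W → ∀ n → + W n ≡ + W (suc (suc n)) ℤ.- + W (suc n)
pos-fibLike-pred {W} W-rec n =
  trans (e (+ W (suc n)) (+ W n)) (cong (ℤ._- + W (suc n)) (sym (pos-fibLike W-rec n)))
  where e : ∀ a b → b ≡ (a ℤ.+ b) ℤ.- a
        e = ℤ-solve-∀

Agree : ℕ → (ℕ → ℕ) → (ℕ → ℕ) → ℕ → Set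
Agree P V W x = (+ V x ≡ + W x mod P) × (+ V (suc x) ≡ + W (suc x) mod P)

agree-pred : ∀ {P V W x} → FibLike V → FibLike W → Agree P V W (suc x) → Agree P V W x
agree-pred {P} {V} {W} {x} V-rec W-rec (V≡W[1+x] , V≡W[2+x]) = V≡W[x] , V≡W[1+x]
  where
    open ≡-mod-Reasoning P
    V≡W[x] : + V x ≡ + W x mod P
    V≡W[x] = begin
      + V x                               ≡⟨ pos-fibLike-pred V-rec x ⟩
      + V (suc (suc x)) ℤ.- + V (suc x)   ≈⟨ -‿cong₂-mod V≡W[2+x] V≡W[1+x] ⟩
      + W (suc (suc x)) ℤ.- + W (suc x)   ≡⟨ pos-fibLike-pred W-rec x ⟨
      + W x                               ∎

agree-zero : ∀ {P V W} → FibLike V → FibLike W → ∀ x → Agree P V W x → Agree P V W 0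
agree-zero V-rec W-rec zero    agree = agree
agree-zero V-rec W-rec (suc x) agree = agree-zero V-rec W-rec x (agree-pred V-rec W-rec agree)

residue : (P : ℕ) .{{_ : NonZero P}} → ℕ → Fin P
residue P a = fromℕ< (n%ℕd<d (+ a) P)

residue-≡⇒≡-mod : ∀ {P} .{{_ : NonZero P}} {a b} →
                  residue P a ≡ residue P b → + a ≡ + b mod P
residue-≡⇒≡-mod {P} {a = a} {b} eq = begin
  + a                      ≈⟨ ≡-mod-%ℕ (+ a) ⟩
  + (+ a %ℕ P)             ≡⟨ cong +_ (toℕ-residue a) ⟨
  + toℕ (residue P a)      ≡⟨ cong (+_ ∘ toℕ) eq ⟩
  + toℕ (residue P b)      ≡⟨ cong +_ (toℕ-residue b) ⟩
  + (+ b %ℕ P)             ≈⟨ ≡-mod-%ℕ (+ b) ⟨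
  + b                      ∎
  where
    open ≡-mod-Reasoning P
    toℕ-residue : ∀ a → toℕ (residue P a) ≡ + a %ℕ P
    toℕ-residue a = Fin.toℕ-fromℕ< (n%ℕd<d (+ a) P)

fib-state : (P : ℕ) .{{_ : NonZero P}} → ℕ → Fin (P * P)
fib-state P k = combine (residue P (fib k)) (residue P (fib (suc k)))

-- Opaque: unfolding the pigeonhole witness makes checking the uses of this lemma blow up.
opaque
  fib-period : ∀ P .{{_ : NonZero P}} →
               ∃ λ o → (+ fib (suc o) ≡ + 0 mod P) × (+ fib (suc (suc o)) ≡ + 1 mod P)
  fib-period P
    with i , j , i<j , same-state ← Fin.pigeonhole (ℕ.n<1+n (P * P)) (fib-state P ∘ toℕ)
    with o , i+1+o≡j ← ℕ.m≤n⇒∃[o]m+o≡n i<j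
    = o , agree-zero shifted-fibLike fib-fibLike (toℕ i) (V≡F[i] , V≡F[1+i])
    where
      shifted-fibLike : FibLike (λ x → fib (x + suc o))
      shifted-fibLike = fibLike λ _ → refl
      j≡i+1+o : toℕ j ≡ toℕ i + suc o
      j≡i+1+o = trans (sym i+1+o≡j) (sym (ℕ.+-suc (toℕ i) o))
      same-residues : residue P (fib (toℕ i)) ≡ residue P (fib (toℕ j))
                    × residue P (fib (suc (toℕ i))) ≡ residue P (fib (suc (toℕ j)))
      same-residues = Fin.combine-injective _ _ _ _ same-state
      V≡F[i] : + fib (toℕ i + suc o) ≡ + fib (toℕ i) mod P
      V≡F[i] = subst (λ t → + fib t ≡ + fib (toℕ i) mod P) j≡i+1+o
                 (≡-mod-sym (residue-≡⇒≡-mod (proj₁ same-residues)))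
      V≡F[1+i] : + fib (suc (toℕ i + suc o)) ≡ + fib (suc (toℕ i)) mod P
      V≡F[1+i] = subst (λ t → + fib (suc t) ≡ + fib (suc (toℕ i)) mod P) j≡i+1+o
                   (≡-mod-sym (residue-≡⇒≡-mod (proj₂ same-residues)))

CofactorsCover : (ℕ → ℕ) → ℕ → Set
CofactorsCover s P =
  ∃ λ f → ∀ c → ∃ λ i → ∃ λ G → s (suc i) ≡ f * G × (+ G ≡ c mod P)

module FibonacciMultiples {P o : ℕ}
    (F[1+o]≡0 : + fib (suc o) ≡ + 0 mod P) (F[2+o]≡1 : + fib (suc (suc o)) ≡ + 1 mod P) where

  F[o]≡1 : + fib o ≡ + 1 mod P
  F[o]≡1 = begin
    + fib o                                 ≡⟨ pos-fibLike-pred fib-fibLike o ⟩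
    + fib (suc (suc o)) ℤ.- + fib (suc o)   ≈⟨ -‿cong₂-mod F[2+o]≡1 F[1+o]≡0 ⟩
    + 1                                     ∎
    where open ≡-mod-Reasoning P

  fib-multiple : ∀ j → ∃ λ G → fib (j * suc o) ≡ fib (suc o) * G × (+ G ≡ + j mod P)
                                × (+ fib (suc (j * suc o)) ≡ + 1 mod P)
  fib-multiple zero = 0 , sym (ℕ.*-zeroʳ (fib (suc o))) , ≡-mod-refl , ≡-mod-refl
  fib-multiple (suc j) with G , F[jn]≡FnG , G≡j , F[1+jn]≡1 ← fib-multiple j =
    G′ , F[n+jn]≡FnG′ , G′≡1+j , F[1+n+jn]≡1
    where
      n = suc o
      G′ = fib (suc (j * n)) + G * fib o
      n+jn≡jn+n : suc (o + j * n) ≡ j * n + n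
      n+jn≡jn+n = trans (cong suc (ℕ.+-comm o (j * n))) (sym (ℕ.+-suc (j * n) o))

      F[n+jn]≡FnG′ : fib (suc j * n) ≡ fib n * G′
      F[n+jn]≡FnG′ = begin
        fib (suc (o + j * n))
          ≡⟨ cong (fib ∘ suc) (ℕ.+-comm o (j * n)) ⟩
        fib (suc (j * n + o))
          ≡⟨ fibLike-+ fib-fibLike (j * n) o ⟩
        fib (suc (j * n)) * fib n + fib (j * n) * fib o
          ≡⟨ cong (λ t → fib (suc (j * n)) * fib n + t * fib o) F[jn]≡FnG ⟩
        fib (suc (j * n)) * fib n + fib n * G * fib o
          ≡⟨ e (fib (suc (j * n))) (fib n) G (fib o) ⟩
        fib n * G′ ∎
        where
          open ≡-Reasoning
          e : ∀ a f g b → a * f + f * g * b ≡ f * (a + g * b)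
          e = ℕ-solve-∀

      G′≡1+j : + G′ ≡ + suc j mod P
      G′≡1+j = begin
        + G′                                    ≡⟨ pos-+* (fib (suc (j * n))) G (fib o) ⟩
        + fib (suc (j * n)) ℤ.+ + G ℤ.* + fib o  ≈⟨ +-cong-mod F[1+jn]≡1 (*-cong-mod G≡j F[o]≡1) ⟩
        + 1 ℤ.+ + j ℤ.* + 1                     ≡⟨ cong (ℤ._+_ (+ 1)) (ℤ.*-identityʳ (+ j)) ⟩
        + suc j                                 ∎
        where open ≡-mod-Reasoning P

      F[1+n+jn]≡1 : + fib (suc (suc j * n)) ≡ + 1 mod P
      F[1+n+jn]≡1 = begin
        + fib (suc (suc (o + j * n)))
          ≡⟨ cong (λ t → + fib (suc t)) n+jn≡jn+n ⟩
        + fib (suc (j * n + n))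
          ≡⟨ pos-fibLike-+ fib-fibLike (j * n) n ⟩
        + fib (suc (j * n)) ℤ.* + fib (suc n) ℤ.+ + fib (j * n) ℤ.* + fib n
          ≈⟨ +-cong-mod (*-cong-mod F[1+jn]≡1 F[2+o]≡1) (*-congˡ-mod (+ fib (j * n)) F[1+o]≡0) ⟩
        + 1 ℤ.* + 1 ℤ.+ + fib (j * n) ℤ.* + 0
          ≡⟨ cong (ℤ._+_ (+ 1)) (ℤ.*-zeroʳ (+ fib (j * n))) ⟩
        + 1 ∎
        where open ≡-mod-Reasoning P

fib-cover : ∀ P .{{_ : NonZero P}} → CofactorsCover fib P
-- The multiplier is P + (c mod P) rather than c mod P, so that the index j · (o + 1) is positive.
fib-cover P@(suc P′) with o , F[1+o]≡0 , F[2+o]≡1 ← fib-period P = fib (suc o) , cover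
  where
    open FibonacciMultiples {P} {o} F[1+o]≡0 F[2+o]≡1

    P+r≡c : ∀ c → + (P + c %ℕ P) ≡ c mod P
    P+r≡c c = begin
      + (P + c %ℕ P)        ≡⟨ ℤ.pos-+ P (c %ℕ P) ⟩
      + P ℤ.+ + (c %ℕ P)    ≈⟨ +-congʳ-mod (+ (c %ℕ P)) (ℕ∣⇒≡0-mod (∣-refl {P})) ⟩
      + (c %ℕ P)            ≈⟨ ≡-mod-%ℕ c ⟨
      c                     ∎
      where open ≡-mod-Reasoning P

    cover : ∀ c → ∃ λ i → ∃ λ G → fib (suc i) ≡ fib (suc o) * G × (+ G ≡ c mod P)
    cover c with G , F[jn]≡FnG , G≡j , _ ← fib-multiple (P + c %ℕ P) =
      o + (P′ + c %ℕ P) * suc o , G , F[jn]≡FnG , ≡-mod-trans G≡j (P+r≡c c)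

cassini : ∀ n → + fib (suc (suc n)) ℤ.* + fib n ℤ.- + fib (suc n) ℤ.* + fib (suc n)
                ≡ ℤ.-1ℤ ℤ.^ suc n
cassini zero    = refl
cassini (suc n) = begin
  + fib (suc (suc (suc n))) ℤ.* + fib (suc n) ℤ.- + fib (suc (suc n)) ℤ.* + fib (suc (suc n))
    ≡⟨ cong₂ (λ x y → x ℤ.* + fib (suc n) ℤ.- y ℤ.* y) F[3+n] F[2+n] ⟩
  ((a ℤ.+ b) ℤ.+ a) ℤ.* a ℤ.- (a ℤ.+ b) ℤ.* (a ℤ.+ b)
    ≡⟨ e a b ⟩
  ℤ.-1ℤ ℤ.* (+ fib (suc (suc n)) ℤ.* b ℤ.- a ℤ.* a)
    ≡⟨ cong (ℤ._*_ ℤ.-1ℤ) (cassini n) ⟩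
  ℤ.-1ℤ ℤ.^ suc (suc n) ∎
  where
    open ≡-Reasoning
    a = + fib (suc n)
    b = + fib n
    F[2+n] : + fib (suc (suc n)) ≡ a ℤ.+ b
    F[2+n] = pos-fibLike fib-fibLike n
    F[3+n] : + fib (suc (suc (suc n))) ≡ (a ℤ.+ b) ℤ.+ a
    F[3+n] = trans (pos-fibLike fib-fibLike (suc n)) (cong (ℤ._+ a) F[2+n])
    e : ∀ a b → ((a ℤ.+ b) ℤ.+ a) ℤ.* a ℤ.- (a ℤ.+ b) ℤ.* (a ℤ.+ b)
              ≡ ℤ.-1ℤ ℤ.* ((a ℤ.+ b) ℤ.* b ℤ.- a ℤ.* a)
    e = ℤ-solve-∀

-1ℤ^n*-1ℤ^n≡1 : ∀ n → ℤ.-1ℤ ℤ.^ n ℤ.* ℤ.-1ℤ ℤ.^ n ≡ + 1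
-1ℤ^n*-1ℤ^n≡1 zero    = refl
-1ℤ^n*-1ℤ^n≡1 (suc n) = trans (e (ℤ.-1ℤ ℤ.^ n)) (-1ℤ^n*-1ℤ^n≡1 n)
  where e : ∀ s → (ℤ.-1ℤ ℤ.* s) ℤ.* (ℤ.-1ℤ ℤ.* s) ≡ s ℤ.* s
        e = ℤ-solve-∀

fib-double : ∀ m′ → fib (suc (suc m′ + m′)) ≡ fib (suc m′) * lucas (suc m′)
fib-double m′ = begin
  fib (suc (m + m′))                       ≡⟨ fibLike-+ fib-fibLike m m′ ⟩
  fib (suc m) * fib m + fib m * fib m′     ≡⟨ e (fib m) (fib m′) ⟩
  fib m * (fib m + 2 * fib m′)             ≡⟨ cong (fib m *_) (lucas≡fib+2fib m′) ⟨
  fib m * lucas m                          ∎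
  where
    open ≡-Reasoning
    m = suc m′
    e : ∀ a b → (a + b) * a + a * b ≡ a * (a + 2 * b)
    e = ℕ-solve-∀

module LucasMultiples {P m′ : ℕ} (L[m]≡0 : + lucas (suc m′) ≡ + 0 mod P) where

  m : ℕ
  m = suc m′

  -- F(2m+1); throughout, m + m′ = 2m − 1.
  Λ : ℤ
  Λ = + fib (suc (suc (m + m′)))

  private
    u v w : ℤ
    u = + fib (suc m)
    v = + fib m
    w = + fib m′

    L[m]≡v+2w : + lucas m ≡ v ℤ.+ + 2 ℤ.* w
    L[m]≡v+2w = trans (cong +_ (lucas≡fib+2fib m′)) (pos-+* (fib m) 2 (fib m′))

    Λ≡u²+v² : Λ ≡ u ℤ.* u ℤ.+ v ℤ.* v
    Λ≡u²+v² =
      trans (cong (λ k → + fib (suc k)) (sym (ℕ.+-suc m m′))) (pos-fibLike-+ fib-fibLike m m)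

  F[2m]≡0 : + fib (suc (m + m′)) ≡ + 0 mod P
  F[2m]≡0 = begin
    + fib (suc (m + m′))       ≡⟨ cong +_ (fib-double m′) ⟩
    + (fib m * lucas m)        ≡⟨ ℤ.pos-* (fib m) (lucas m) ⟩
    v ℤ.* + lucas m            ≈⟨ *-congˡ-mod v L[m]≡0 ⟩
    v ℤ.* + 0                  ≡⟨ ℤ.*-zeroʳ v ⟩
    + 0                        ∎
    where open ≡-mod-Reasoning P

  F[2m-1]≡Λ : + fib (m + m′) ≡ Λ mod P
  F[2m-1]≡Λ = begin
    + fib (m + m′)                       ≡⟨ pos-fibLike-pred fib-fibLike (m + m′) ⟩
    Λ ℤ.- + fib (suc (m + m′))           ≈⟨ +-congˡ-mod Λ (-‿cong-mod F[2m]≡0) ⟩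
    Λ ℤ.- + 0                            ≡⟨ ℤ.+-identityʳ Λ ⟩
    Λ                                    ∎
    where open ≡-mod-Reasoning P

  Λ≡-1^[m+1] : Λ ≡ ℤ.-1ℤ ℤ.^ suc m mod P
  Λ≡-1^[m+1] = begin
    Λ
      ≡⟨ Λ≡u²+v² ⟩
    u ℤ.* u ℤ.+ v ℤ.* v
      ≡⟨ e v w ⟩
    ℤ.-1ℤ ℤ.* (u ℤ.* w ℤ.- v ℤ.* v) ℤ.+ u ℤ.* (v ℤ.+ + 2 ℤ.* w)
      ≡⟨ cong₂ (λ x y → ℤ.-1ℤ ℤ.* x ℤ.+ u ℤ.* y) (cassini m′) (sym L[m]≡v+2w) ⟩
    ℤ.-1ℤ ℤ.^ suc m ℤ.+ u ℤ.* + lucas m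
      ≈⟨ +-congˡ-mod (ℤ.-1ℤ ℤ.^ suc m) (*-congˡ-mod u L[m]≡0) ⟩
    ℤ.-1ℤ ℤ.^ suc m ℤ.+ u ℤ.* + 0
      ≡⟨ cong (ℤ._+_ (ℤ.-1ℤ ℤ.^ suc m)) (ℤ.*-zeroʳ u) ⟩
    ℤ.-1ℤ ℤ.^ suc m ℤ.+ + 0
      ≡⟨ ℤ.+-identityʳ _ ⟩
    ℤ.-1ℤ ℤ.^ suc m ∎
    where
      open ≡-mod-Reasoning P
      e : ∀ v w → (v ℤ.+ w) ℤ.* (v ℤ.+ w) ℤ.+ v ℤ.* v
                ≡ ℤ.-1ℤ ℤ.* ((v ℤ.+ w) ℤ.* w ℤ.- v ℤ.* v)
                  ℤ.+ (v ℤ.+ w) ℤ.* (v ℤ.+ + 2 ℤ.* w)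
      e = ℤ-solve-∀

  Λ²≡1 : Λ ℤ.* Λ ≡ + 1 mod P
  Λ²≡1 =
    ≡-mod-trans (*-cong-mod Λ≡-1^[m+1] Λ≡-1^[m+1]) (≡⇒≡-mod (-1ℤ^n*-1ℤ^n≡1 (suc m)))

  L[m+1]F[m]≡2Λ : + lucas (suc m) ℤ.* v ≡ + 2 ℤ.* Λ mod P
  L[m+1]F[m]≡2Λ = begin
    + lucas (suc m) ℤ.* v
      ≡⟨ cong (ℤ._* v) L[m+1]≡u+2v ⟩
    (u ℤ.+ + 2 ℤ.* v) ℤ.* v
      ≡⟨ e v w ⟩
    + 2 ℤ.* (u ℤ.* u ℤ.+ v ℤ.* v) ℤ.- u ℤ.* (v ℤ.+ + 2 ℤ.* w)
      ≡⟨ cong₂ (λ x y → + 2 ℤ.* x ℤ.- u ℤ.* y) (sym Λ≡u²+v²) (sym L[m]≡v+2w) ⟩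
    + 2 ℤ.* Λ ℤ.- u ℤ.* + lucas m
      ≈⟨ +-congˡ-mod (+ 2 ℤ.* Λ) (-‿cong-mod (*-congˡ-mod u L[m]≡0)) ⟩
    + 2 ℤ.* Λ ℤ.- u ℤ.* + 0
      ≡⟨ cong (λ x → + 2 ℤ.* Λ ℤ.- x) (ℤ.*-zeroʳ u) ⟩
    + 2 ℤ.* Λ ℤ.- + 0
      ≡⟨ ℤ.+-identityʳ _ ⟩
    + 2 ℤ.* Λ ∎
    where
      open ≡-mod-Reasoning P
      L[m+1]≡u+2v : + lucas (suc m) ≡ u ℤ.+ + 2 ℤ.* v
      L[m+1]≡u+2v = trans (cong +_ (lucas≡fib+2fib m)) (pos-+* (fib (suc m)) 2 (fib m))
      e : ∀ v w → ((v ℤ.+ w) ℤ.+ + 2 ℤ.* v) ℤ.* v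
                ≡ + 2 ℤ.* ((v ℤ.+ w) ℤ.* (v ℤ.+ w) ℤ.+ v ℤ.* v)
                  ℤ.- (v ℤ.+ w) ℤ.* (v ℤ.+ + 2 ℤ.* w)
      e = ℤ-solve-∀

  lucas-odd-multiple : ∀ i → ∃ λ G → lucas ((1 + 2 * i) * m) ≡ lucas m * G
                         × (+ G ≡ Λ ℤ.^ i ℤ.* + (1 + 2 * i) mod P)
                         × (+ lucas (suc ((1 + 2 * i) * m)) ≡ Λ ℤ.^ i ℤ.* + lucas (suc m) mod P)
  lucas-odd-multiple zero =
    1 , trans (cong lucas (ℕ.+-identityʳ m)) (sym (ℕ.*-identityʳ (lucas m))) , ≡-mod-refl ,
    ≡⇒≡-mod (trans (cong (λ k → + lucas (suc k)) (ℕ.+-identityʳ m))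
                   (sym (ℤ.*-identityˡ (+ lucas (suc m)))))
  lucas-odd-multiple (suc i) with G , L[X]≡LmG , G≡Λⁱs , L[1+X]≡ΛⁱL ← lucas-odd-multiple i =
    G′ , L[X′]≡LmG′ , G′≡Λⁱ⁺¹s′ , L[1+X′]≡Λⁱ⁺¹L
    where
      X = (1 + 2 * i) * m
      B = m + m′
      X′≡1+X+B : (1 + 2 * suc i) * m ≡ suc (X + B)
      X′≡1+X+B = e i m′
        where e : ∀ i m′ →
                  (1 + 2 * suc i) * suc m′ ≡ suc ((1 + 2 * i) * suc m′ + (suc m′ + m′))
              e = ℕ-solve-∀
      G′ = lucas (suc X) * fib m + G * fib B

      L[X′]≡LmG′ : lucas ((1 + 2 * suc i) * m) ≡ lucas m * G′
      L[X′]≡LmG′ = begin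
        lucas ((1 + 2 * suc i) * m)
          ≡⟨ cong lucas X′≡1+X+B ⟩
        lucas (suc (X + B))
          ≡⟨ fibLike-+ lucas-fibLike X B ⟩
        lucas (suc X) * fib (suc B) + lucas X * fib B
          ≡⟨ cong₂ (λ x y → lucas (suc X) * x + y * fib B) (fib-double m′) L[X]≡LmG ⟩
        lucas (suc X) * (fib m * lucas m) + lucas m * G * fib B
          ≡⟨ e (lucas (suc X)) (fib m) (lucas m) G (fib B) ⟩
        lucas m * G′ ∎
        where
          open ≡-Reasoning
          e : ∀ a f l g b → a * (f * l) + l * g * b ≡ l * (a * f + g * b)
          e = ℕ-solve-∀

      G′≡Λⁱ⁺¹s′ : + G′ ≡ Λ ℤ.^ suc i ℤ.* + (1 + 2 * suc i) mod P
      G′≡Λⁱ⁺¹s′ = begin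
        + G′
          ≡⟨ pos-*+* (lucas (suc X)) (fib m) G (fib B) ⟩
        + lucas (suc X) ℤ.* v ℤ.+ + G ℤ.* + fib B
          ≈⟨ +-cong-mod (*-congʳ-mod v L[1+X]≡ΛⁱL) (*-cong-mod G≡Λⁱs F[2m-1]≡Λ) ⟩
        Λ ℤ.^ i ℤ.* + lucas (suc m) ℤ.* v ℤ.+ Λ ℤ.^ i ℤ.* s ℤ.* Λ
          ≡⟨ e (Λ ℤ.^ i) (+ lucas (suc m)) v s Λ ⟩
        Λ ℤ.^ i ℤ.* (+ lucas (suc m) ℤ.* v) ℤ.+ Λ ℤ.* Λ ℤ.^ i ℤ.* s
          ≈⟨ +-congʳ-mod (Λ ℤ.* Λ ℤ.^ i ℤ.* s) (*-congˡ-mod (Λ ℤ.^ i) L[m+1]F[m]≡2Λ) ⟩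
        Λ ℤ.^ i ℤ.* (+ 2 ℤ.* Λ) ℤ.+ Λ ℤ.* Λ ℤ.^ i ℤ.* s
          ≡⟨ e′ (Λ ℤ.^ i) Λ s ⟩
        Λ ℤ.^ suc i ℤ.* (s ℤ.+ + 2)
          ≡⟨ cong (Λ ℤ.^ suc i ℤ.*_) s′≡s+2 ⟨
        Λ ℤ.^ suc i ℤ.* + (1 + 2 * suc i) ∎
        where
          open ≡-mod-Reasoning P
          s = + (1 + 2 * i)
          s′≡s+2 : + (1 + 2 * suc i) ≡ s ℤ.+ + 2
          s′≡s+2 = trans (cong +_ (e″ i)) (ℤ.pos-+ (1 + 2 * i) 2)
            where e″ : ∀ i → 1 + 2 * suc i ≡ (1 + 2 * i) + 2
                  e″ = ℕ-solve-∀
          e : ∀ t a b s l →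
              t ℤ.* a ℤ.* b ℤ.+ t ℤ.* s ℤ.* l ≡ t ℤ.* (a ℤ.* b) ℤ.+ l ℤ.* t ℤ.* s
          e = ℤ-solve-∀
          e′ : ∀ t l s → t ℤ.* (+ 2 ℤ.* l) ℤ.+ l ℤ.* t ℤ.* s ≡ l ℤ.* t ℤ.* (s ℤ.+ + 2)
          e′ = ℤ-solve-∀

      L[1+X′]≡Λⁱ⁺¹L :
        + lucas (suc ((1 + 2 * suc i) * m)) ≡ Λ ℤ.^ suc i ℤ.* + lucas (suc m) mod P
      L[1+X′]≡Λⁱ⁺¹L = begin
        + lucas (suc ((1 + 2 * suc i) * m))
          ≡⟨ cong (λ k → + lucas (suc k)) X′≡1+X+B ⟩
        + lucas (suc (suc X + B))
          ≡⟨ pos-fibLike-+ lucas-fibLike (suc X) B ⟩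
        + lucas (suc (suc X)) ℤ.* + fib (suc B) ℤ.+ + lucas (suc X) ℤ.* + fib B
          ≈⟨ +-cong-mod (*-congˡ-mod (+ lucas (suc (suc X))) F[2m]≡0)
                        (*-cong-mod L[1+X]≡ΛⁱL F[2m-1]≡Λ) ⟩
        + lucas (suc (suc X)) ℤ.* + 0 ℤ.+ Λ ℤ.^ i ℤ.* + lucas (suc m) ℤ.* Λ
          ≡⟨ e (+ lucas (suc (suc X))) (Λ ℤ.^ i) (+ lucas (suc m)) Λ ⟩
        Λ ℤ.^ suc i ℤ.* + lucas (suc m) ∎
        where
          open ≡-mod-Reasoning P
          e : ∀ a t l λ′ → a ℤ.* + 0 ℤ.+ t ℤ.* l ℤ.* λ′ ≡ λ′ ℤ.* t ℤ.* l
          e = ℤ-solve-∀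

lucas-lift : ∀ ι m′ → (1 + 2 * ι) ∣ lucas (suc m′) →
             (1 + 2 * ι) * lucas (suc m′) ∣ lucas ((1 + 2 * ι) * suc m′)
lucas-lift ι m′ p∣L[m]
  with G , L[pm]≡L[m]G , G≡Λ^ιp , _ ←
         LucasMultiples.lucas-odd-multiple {m′ = m′} (ℕ∣⇒≡0-mod p∣L[m]) ι =
  subst₂ _∣_ (ℕ.*-comm (lucas (suc m′)) p) (sym L[pm]≡L[m]G)
             (*-monoʳ-∣ (lucas (suc m′)) p∣G)
  where
    p = 1 + 2 * ι
    open LucasMultiples {m′ = m′} (ℕ∣⇒≡0-mod p∣L[m])
    p∣G : p ∣ G
    p∣G = ≡0-mod⇒∣-abs (≡-mod-trans G≡Λ^ιp (*-modulus≡0-mod (Λ ℤ.^ ι)))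

odd-power∣lucas : ∀ ι s → (1 + 2 * ι) ∣ lucas (suc s) →
                  ∀ K → ∃ λ m′ → (1 + 2 * ι) ^ suc K ∣ lucas (suc m′)
odd-power∣lucas ι s p∣L[s] zero = s , subst (_∣ lucas (suc s)) (sym (ℕ.*-identityʳ _)) p∣L[s]
odd-power∣lucas ι s p∣L[s] (suc K) with m′ , pᴷ⁺¹∣L[m] ← odd-power∣lucas ι s p∣L[s] K =
  m′ + 2 * ι * suc m′ ,
  ∣-trans (*-monoʳ-∣ p pᴷ⁺¹∣L[m]) (lucas-lift ι m′ (∣-trans (m∣m*n (p ^ K)) pᴷ⁺¹∣L[m]))
  where p = 1 + 2 * ι

1+4*-hits-residues : ∀ h c → ∃ λ a → + (1 + 2 * (2 * a)) ≡ c mod (1 + 2 * h)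
-- 4(h+1)² = (P+1)² ≡ 1 (mod P), so 1 + 4(h+1)²r ≡ 1 + r.
1+4*-hits-residues h c = suc h * suc h * r , (begin
  + (1 + 2 * (2 * (suc h * suc h * r)))
    ≡⟨ cong +_ (e h r) ⟩
  + ((1 + r) + (P + 2) * r * P)
    ≡⟨ pos-+* (1 + r) ((P + 2) * r) P ⟩
  + (1 + r) ℤ.+ + ((P + 2) * r) ℤ.* + P
    ≈⟨ +-congˡ-mod (+ (1 + r)) (*-modulus≡0-mod (+ ((P + 2) * r))) ⟩
  + (1 + r) ℤ.+ + 0
    ≡⟨ ℤ.+-identityʳ (+ (1 + r)) ⟩
  + 1 ℤ.+ + r
    ≈⟨ +-congˡ-mod (+ 1) (≡-mod-%ℕ (c ℤ.- + 1)) ⟨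
  + 1 ℤ.+ (c ℤ.- + 1)
    ≡⟨ e′ c ⟩
  c ∎)
  where
    P = 1 + 2 * h
    r = (c ℤ.- + 1) %ℕ P
    open ≡-mod-Reasoning P
    e : ∀ h r → 1 + 2 * (2 * (suc h * suc h * r)) ≡ (1 + r) + ((1 + 2 * h) + 2) * r * (1 + 2 * h)
    e = ℕ-solve-∀
    e′ : ∀ c → + 1 ℤ.+ (c ℤ.- + 1) ≡ c
    e′ = ℤ-solve-∀

lucas-cover : ∀ h m′ → (1 + 2 * h) ∣ lucas (suc m′) → CofactorsCover lucas (1 + 2 * h)
lucas-cover h m′ P∣L[m] = lucas (suc m′) , cover
  where
    P = 1 + 2 * h
    open LucasMultiples {m′ = m′} (ℕ∣⇒≡0-mod P∣L[m])

    cover : ∀ c → ∃ λ i → ∃ λ G → lucas (suc i) ≡ lucas (suc m′) * G × (+ G ≡ c mod P)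
    cover c with a , 1+4a≡c ← 1+4*-hits-residues h c
            with G , L≡L[m]G , G≡Λ²ᵃ[1+4a] , _ ←
                   LucasMultiples.lucas-odd-multiple {m′ = m′} (ℕ∣⇒≡0-mod P∣L[m]) (2 * a) =
      m′ + 2 * (2 * a) * suc m′ , G , L≡L[m]G , (begin
        + G                                         ≈⟨ G≡Λ²ᵃ[1+4a] ⟩
        Λ ℤ.^ (2 * a) ℤ.* + (1 + 2 * (2 * a))        ≈⟨ *-cong-mod (^-even≡1-mod Λ²≡1 a) 1+4a≡c ⟩
        + 1 ℤ.* c                                   ≡⟨ ℤ.*-identityˡ c ⟩
        c                                           ∎)
      where open ≡-mod-Reasoning P

lucas-+6 : ∀ n → lucas (6 + n) ≡ lucas (suc n) * 8 + lucas n * 5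
lucas-+6 n = trans (cong (lucas ∘ suc) (ℕ.+-comm 5 n)) (fibLike-+ lucas-fibLike n 5)

8∤lucas : ∀ n → ¬ 8 ∣ lucas n
8∤lucas 0 = from-no (8 ∣? lucas 0)
8∤lucas 1 = from-no (8 ∣? lucas 1)
8∤lucas 2 = from-no (8 ∣? lucas 2)
8∤lucas 3 = from-no (8 ∣? lucas 3)
8∤lucas 4 = from-no (8 ∣? lucas 4)
8∤lucas 5 = from-no (8 ∣? lucas 5)
8∤lucas (suc (suc (suc (suc (suc (suc n)))))) 8∣L[6+n] =
  8∤lucas n (coprime-divisor (from-yes (coprime? 8 5))
                             (subst (8 ∣_) (ℕ.*-comm (lucas n) 5) 8∣5L[n]))
  where
    8∣5L[n] : 8 ∣ lucas n * 5
    8∣5L[n] = ∣m+n∣m⇒∣n (subst (8 ∣_) (lucas-+6 n) 8∣L[6+n]) (n∣m*n (lucas (suc n)))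

toℚᵘ-/ : ∀ i n .{{_ : NonZero n}} → ℚ.toℚᵘ (i ℚ./ n) ℚᵘ.≃ i ℚᵘ./ n
toℚᵘ-/ i (suc n) = ℚ.toℚᵘ-fromℚᵘ (mkℚᵘ i n)

toℚᵘ-/-sub : ∀ i n .{{_ : NonZero n}} (q : ℚ) →
              ℚ.toℚᵘ (i ℚ./ n ℚ.- q) ℚᵘ.≃ i ℚᵘ./ n ℚᵘ.+ ℚᵘ.- ℚ.toℚᵘ q
toℚᵘ-/-sub i n q =
  ℚᵘ.≃-trans (ℚ.toℚᵘ-homo-+ (i ℚ./ n) (ℚ.- q)) (ℚᵘ.+-cong (toℚᵘ-/ i n) (ℚ.toℚᵘ-homo‿- q))

↥-/-sub : ∀ i n .{{_ : NonZero n}} (q : ℚ) →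
          ↥ (i ℚ./ n ℚ.- q) ℤ.* (+ n ℤ.* ↧ q)
          ≡ (i ℤ.* ↧ q ℤ.- ↥ q ℤ.* + n) ℤ.* ↧ (i ℚ./ n ℚ.- q)
↥-/-sub i n@(suc _) q@(mkℚ _ _ _) with *≡* cross ← toℚᵘ-/-sub i n q = begin
  ↥ X ℤ.* (+ n ℤ.* ↧ q)
    ≡⟨ cong (ℤ._* (+ n ℤ.* ↧ q)) (ℚ.↥ᵘ-toℚᵘ X) ⟨
  ℚᵘ.↥ (ℚ.toℚᵘ X) ℤ.* (+ n ℤ.* ↧ q)
    ≡⟨ cross ⟩
  (i ℤ.* ↧ q ℤ.+ ℤ.- ↥ q ℤ.* + n) ℤ.* ℚᵘ.↧ (ℚ.toℚᵘ X)
    ≡⟨ cong₂ ℤ._*_ (e i (↧ q) (↥ q) (+ n)) (ℚ.↧ᵘ-toℚᵘ X) ⟩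
  (i ℤ.* ↧ q ℤ.- ↥ q ℤ.* + n) ℤ.* ↧ X ∎
  where
    open ≡-Reasoning
    X = i ℚ./ n ℚ.- q
    e : ∀ i d a m → i ℤ.* d ℤ.+ ℤ.- a ℤ.* m ≡ i ℤ.* d ℤ.- a ℤ.* m
    e = ℤ-solve-∀

↥-ratio-sub : ∀ {a b} .{{_ : NonZero b}} f {A B} → a ≡ f * A → b ≡ f * B → ∀ q →
              ↥ (+ a ℚ./ b ℚ.- q) ℤ.* (+ B ℤ.* ↧ q)
              ≡ (+ A ℤ.* ↧ q ℤ.- ↥ q ℤ.* + B) ℤ.* ↧ (+ a ℚ./ b ℚ.- q)
↥-ratio-sub {b = b} f {A} {B} refl refl q = ℤ.*-cancelˡ-≡ (+ f) _ _ {{f≢0}} (begin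
  + f ℤ.* (↥ X ℤ.* (+ B ℤ.* ↧ q))
    ≡⟨ e₁ (+ f) (↥ X) (+ B) (↧ q) ⟩
  ↥ X ℤ.* (+ f ℤ.* + B ℤ.* ↧ q)
    ≡⟨ cong (λ t → ↥ X ℤ.* (t ℤ.* ↧ q)) (ℤ.pos-* f B) ⟨
  ↥ X ℤ.* (+ b ℤ.* ↧ q)
    ≡⟨ ↥-/-sub (+ (f * A)) b q ⟩
  (+ (f * A) ℤ.* ↧ q ℤ.- ↥ q ℤ.* + b) ℤ.* ↧ X
    ≡⟨ cong₂ (λ s t → (s ℤ.* ↧ q ℤ.- ↥ q ℤ.* t) ℤ.* ↧ X) (ℤ.pos-* f A) (ℤ.pos-* f B) ⟩
  (+ f ℤ.* + A ℤ.* ↧ q ℤ.- ↥ q ℤ.* (+ f ℤ.* + B)) ℤ.* ↧ X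
    ≡⟨ e₂ (+ f) (+ A) (↧ q) (↥ q) (+ B) (↧ X) ⟩
  + f ℤ.* ((+ A ℤ.* ↧ q ℤ.- ↥ q ℤ.* + B) ℤ.* ↧ X) ∎)
  where
    open ≡-Reasoning
    X = + (f * A) ℚ./ b ℚ.- q
    f≢0 : NonZero f
    f≢0 = ℕ.m*n≢0⇒m≢0 f
    e₁ : ∀ f x b d → f ℤ.* (x ℤ.* (b ℤ.* d)) ≡ x ℤ.* (f ℤ.* b ℤ.* d)
    e₁ = ℤ-solve-∀
    e₂ : ∀ f a d n b x →
         (f ℤ.* a ℤ.* d ℤ.- n ℤ.* (f ℤ.* b)) ℤ.* x ≡ f ℤ.* ((a ℤ.* d ℤ.- n ℤ.* b) ℤ.* x)
    e₂ = ℤ-solve-∀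

QuotientSet : (s : ℕ → ℕ) → (∀ n → NonZero (s (suc n))) → ℚ → Set
QuotientSet s s≢0 r = ∃ λ m → ∃ λ n → r ≡ ((+ s (suc m)) ℚ./ s (suc n)) {{s≢0 n}}

^-monoʳ-∣ : ∀ m {i j} → i ℕ.≤ j → m ^ i ∣ m ^ j
^-monoʳ-∣ m {i} i≤j with o , refl ← ℕ.m≤n⇒∃[o]m+o≡n i≤j =
  subst (m ^ i ∣_) (sym (ℕ.^-distribˡ-+-* m i o)) (m∣m*n (m ^ o))

coprime-↥↧ : ∀ (X : ℚ) → Coprime ℤ.∣ ↥ X ∣ (↧ₙ X)
coprime-↥↧ (mkℚ _ _ coprime) = recompute coprime

module _ {p : ℕ} (prime[p] : Prime p) where

  private instance
    p≢0 : NonZero p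
    p≢0 = prime⇒nonZero prime[p]

  prime-power-divisor : ∀ k {m n} → ¬ p ∣ n → p ^ k ∣ m * n → p ^ k ∣ m
  prime-power-divisor zero    _   _ = 1∣ _
  prime-power-divisor (suc k) {m} {n} p∤n pᵏ⁺¹∣mn
    with euclidsLemma m n prime[p] (∣-trans (m∣m*n (p ^ k)) pᵏ⁺¹∣mn)
  ... | inj₂ p∣n = ⊥-elim (p∤n p∣n)
  ... | inj₁ (divides q refl) =
    subst (_∣ q * p) (ℕ.*-comm (p ^ k) p) (*-monoˡ-∣ p (prime-power-divisor k {q} p∤n pᵏ∣qn))
    where
      pᵏ∣qn : p ^ k ∣ q * n
      pᵏ∣qn = *-cancelˡ-∣ p (subst (p * p ^ k ∣_) (e q p n) pᵏ⁺¹∣mn)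
        where e : ∀ q p n → q * p * n ≡ p * (q * n)
              e = ℕ-solve-∀

  pSmall-of-fraction : ∀ k (X : ℚ) {N D} → ℤ.∣ ↥ X ∣ * D ≡ N * ↧ₙ X →
                       ¬ p ∣ D → p ^ k ∣ N → pSmall p k X
  pSmall-of-fraction k X {N} {D} cross p∤D pᵏ∣N = pᵏ∣numerator , p∤denominator
    where
      pᵏ∣numerator : p ^ k ∣ ℤ.∣ ↥ X ∣
      pᵏ∣numerator =
        prime-power-divisor k p∤D (subst (p ^ k ∣_) (sym cross) (∣m⇒∣m*n (↧ₙ X) pᵏ∣N))

      p∤denominator : ¬ p ∣ ↧ₙ X
      p∤denominator p∣den
        with euclidsLemma ℤ.∣ ↥ X ∣ D prime[p] (subst (p ∣_) (sym cross) (∣n⇒∣m*n N p∣den))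
      ... | inj₂ p∣D   = p∤D p∣D
      ... | inj₁ p∣num = ¬prime[1] (subst Prime (coprime-↥↧ X (p∣num , p∣den)) prime[p])

  pSmall-of-scaled-fraction : ∀ k E (X : ℚ) {N D} → ℤ.∣ ↥ X ∣ * (p ^ E * D) ≡ N * ↧ₙ X →
                              ¬ p ∣ D → p ^ (E + k) ∣ N → pSmall p k X
  pSmall-of-scaled-fraction k E X {N} {D} cross p∤D (divides q N≡qpᴱ⁺ᵏ) =
    pSmall-of-fraction k X cross′ p∤D (n∣m*n q)
    where
      instance pᴱ≢0 : NonZero (p ^ E)
      pᴱ≢0 = ℕ.m^n≢0 p E
      cross′ : ℤ.∣ ↥ X ∣ * D ≡ q * p ^ k * ↧ₙ X
      cross′ = ℕ.*-cancelˡ-≡ _ _ (p ^ E) (begin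
        p ^ E * (ℤ.∣ ↥ X ∣ * D)           ≡⟨ e₁ (p ^ E) ℤ.∣ ↥ X ∣ D ⟩
        ℤ.∣ ↥ X ∣ * (p ^ E * D)           ≡⟨ cross ⟩
        N * ↧ₙ X                          ≡⟨ cong (_* ↧ₙ X) N≡qpᴱ⁺ᵏ ⟩
        q * p ^ (E + k) * ↧ₙ X            ≡⟨ cong (λ t → q * t * ↧ₙ X) (ℕ.^-distribˡ-+-* p E k) ⟩
        q * (p ^ E * p ^ k) * ↧ₙ X        ≡⟨ e₂ q (p ^ E) (p ^ k) (↧ₙ X) ⟩
        p ^ E * (q * p ^ k * ↧ₙ X)        ∎)
        where
          open ≡-Reasoning
          e₁ : ∀ a b c → a * (b * c) ≡ b * (a * c)
          e₁ = ℕ-solve-∀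
          e₂ : ∀ q a b d → q * (a * b) * d ≡ a * (q * b * d)
          e₂ = ℕ-solve-∀

  PrimePowerSplit : ℕ → Set
  PrimePowerSplit d = ∃ λ e → ∃ λ d′ → d ≡ p ^ e * d′ × ¬ p ∣ d′

  prime-power-split : ∀ d .{{_ : NonZero d}} → PrimePowerSplit d
  prime-power-split d = split d (<-wellFounded d)
    where
      split : ∀ d .{{_ : NonZero d}} → Acc _<_ d → PrimePowerSplit d
      split d (acc smaller) with p ∣? d
      ... | no p∤d = 0 , d , sym (ℕ.+-identityʳ d) , p∤d
      ... | yes (divides q refl) = times-p (split q (smaller q<qp))
        where
          instance q≢0 : NonZero q
          q≢0 = ℕ.m*n≢0⇒m≢0 q
          q<qp : q < q * p
          q<qp = ℕ.m<m*n q p (ℕ.nonTrivial⇒n>1 p {{prime⇒nonTrivial prime[p]}})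
          times-p : PrimePowerSplit q → PrimePowerSplit (q * p)
          times-p (e , d′ , q≡pᵉd′ , p∤d′) =
            suc e , d′ , trans (cong (_* p) q≡pᵉd′) (e₁ p (p ^ e) d′) , p∤d′
            where e₁ : ∀ p a d → a * d * p ≡ p * a * d
                  e₁ = ℕ-solve-∀

  exact-power-of-congruent : ∀ e {P B d d′} → p ^ suc e ∣ P → d ≡ p ^ e * d′ → ¬ p ∣ d′ →
                             + B ≡ + d mod P → ∃ λ u → B ≡ p ^ e * u × ¬ p ∣ u
  exact-power-of-congruent e {P} {B} {d} {d′} pᵉ⁺¹∣P refl p∤d′ B≡d
    with divides u B≡upᵉ ← ∣-cong-mod (∣-trans (n∣m*n p) pᵉ⁺¹∣P) B≡d (m∣m*n d′) =
    u , trans B≡upᵉ (ℕ.*-comm u (p ^ e)) , p∤u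
    where
      instance pᵉ≢0 : NonZero (p ^ e)
      pᵉ≢0 = ℕ.m^n≢0 p e
      p∤u : ¬ p ∣ u
      p∤u p∣u =
        p∤d′ (*-cancelˡ-∣ (p ^ e) (subst (_∣ p ^ e * d′) (ℕ.*-comm p (p ^ e)) pᵉ⁺¹∣d))
        where
          pᵉ⁺¹∣B : p ^ suc e ∣ B
          pᵉ⁺¹∣B = subst (p ^ suc e ∣_) (sym B≡upᵉ) (*-monoˡ-∣ (p ^ e) p∣u)
          pᵉ⁺¹∣d : p ^ suc e ∣ p ^ e * d′
          pᵉ⁺¹∣d = ∣-cong-mod pᵉ⁺¹∣P (≡-mod-sym B≡d) pᵉ⁺¹∣B

  cover⇒dense : ∀ s (s≢0 : ∀ n → NonZero (s (suc n))) → (∀ K → CofactorsCover s (p ^ K)) →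
                DenseInQp p (QuotientSet s s≢0)
  -- With K = (2e + k) + (e + 1): B ≡ d mod p^(e+1) gives p^e ∥ B, and p^(2e+k) ∣ Ad − cB.
  cover⇒dense s s≢0 cover q k
    with e , d′ , d≡pᵉd′ , p∤d′ ← prime-power-split (↧ₙ q)
    with f , hit ← cover (e + e + k + suc e)
    with m , A , sₘ≡fA , A≡c ← hit (↥ q)
    with n , B , sₙ≡fB , B≡d ← hit (+ ↧ₙ q)
    with u , B≡pᵉu , p∤u ← exact-power-of-congruent e (^-monoʳ-∣ p (ℕ.m≤n+m (suc e) (e + e + k)))
                                                     d≡pᵉd′ p∤d′ B≡d
    = _ , (m , n , refl) , pSmall-of-scaled-fraction k (e + e) X cross p∤ud′ pᵉ⁺ᵉ⁺ᵏ∣N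
    where
      c = ↥ q
      d = ↧ₙ q
      X = (+ s (suc m) ℚ./ s (suc n)) {{s≢0 n}} ℚ.- q
      N = + A ℤ.* + d ℤ.- c ℤ.* + B

      N≡0 : N ≡ + 0 mod p ^ (e + e + k + suc e)
      N≡0 = begin
        + A ℤ.* + d ℤ.- c ℤ.* + B
          ≈⟨ -‿cong₂-mod (*-congʳ-mod (+ d) A≡c) (*-congˡ-mod c B≡d) ⟩
        c ℤ.* + d ℤ.- c ℤ.* + d
          ≡⟨ ℤ.+-inverseʳ (c ℤ.* + d) ⟩
        + 0 ∎
        where open ≡-mod-Reasoning (p ^ (e + e + k + suc e))

      pᵉ⁺ᵉ⁺ᵏ∣N : p ^ (e + e + k) ∣ ℤ.∣ N ∣
      pᵉ⁺ᵉ⁺ᵏ∣N =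
        ∣-trans (^-monoʳ-∣ p (ℕ.m≤m+n (e + e + k) (suc e))) (≡0-mod⇒∣-abs N≡0)

      p∤ud′ : ¬ p ∣ u * d′
      p∤ud′ p∣ud′ = [ p∤u , p∤d′ ]′ (euclidsLemma u d′ prime[p] p∣ud′)

      Bd≡pᵉ⁺ᵉud′ : B * d ≡ p ^ (e + e) * (u * d′)
      Bd≡pᵉ⁺ᵉud′ = begin
        B * d                       ≡⟨ cong₂ _*_ B≡pᵉu d≡pᵉd′ ⟩
        p ^ e * u * (p ^ e * d′)    ≡⟨ e₁ (p ^ e) u d′ ⟩
        p ^ e * p ^ e * (u * d′)    ≡⟨ cong (_* (u * d′)) (ℕ.^-distribˡ-+-* p e e) ⟨
        p ^ (e + e) * (u * d′)      ∎
        where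
          open ≡-Reasoning
          e₁ : ∀ a u d → a * u * (a * d) ≡ a * a * (u * d)
          e₁ = ℕ-solve-∀

      cross : ℤ.∣ ↥ X ∣ * (p ^ (e + e) * (u * d′)) ≡ ℤ.∣ N ∣ * ↧ₙ X
      cross = begin
        ℤ.∣ ↥ X ∣ * (p ^ (e + e) * (u * d′))
          ≡⟨ cong (ℤ.∣ ↥ X ∣ *_) Bd≡pᵉ⁺ᵉud′ ⟨
        ℤ.∣ ↥ X ∣ * (B * d)
          ≡⟨ cong (ℤ.∣ ↥ X ∣ *_) (ℤ.abs-* (+ B) (+ d)) ⟨
        ℤ.∣ ↥ X ∣ * ℤ.∣ + B ℤ.* + d ∣
          ≡⟨ ℤ.abs-* (↥ X) (+ B ℤ.* + d) ⟨
        ℤ.∣ ↥ X ℤ.* (+ B ℤ.* + d) ∣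
          ≡⟨ cong ℤ.∣_∣ (↥-ratio-sub {{s≢0 n}} f sₘ≡fA sₙ≡fB q) ⟩
        ℤ.∣ N ℤ.* ↧ X ∣
          ≡⟨ ℤ.abs-* N (↧ X) ⟩
        ℤ.∣ N ∣ * ↧ₙ X ∎
        where open ≡-Reasoning

  dense⇒p^k∣term : ∀ s (s≢0 : ∀ n → NonZero (s (suc n))) → DenseInQp p (QuotientSet s s≢0) →
                   ∀ k → ∃ λ m → p ^ k ∣ s (suc m)
  dense⇒p^k∣term s s≢0 dense k with _ , (m , n , refl) , pᵏ∣num , p∤den ← dense ℚ.0ℚ k =
    m , prime-power-divisor k p∤den (subst (p ^ k ∣_) cross (∣m⇒∣m*n b pᵏ∣num))
    where
      a = s (suc m)
      b = s (suc n)
      X = (+ a ℚ./ b) {{s≢0 n}} ℚ.- ℚ.0ℚ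
      cross : ℤ.∣ ↥ X ∣ * b ≡ a * ↧ₙ X
      cross = begin
        ℤ.∣ ↥ X ∣ * b
          ≡⟨ cong (λ t → ℤ.∣ ↥ X ∣ * ℤ.∣ t ∣) (ℤ.*-identityʳ (+ b)) ⟨
        ℤ.∣ ↥ X ∣ * ℤ.∣ + b ℤ.* + 1 ∣
          ≡⟨ ℤ.abs-* (↥ X) (+ b ℤ.* + 1) ⟨
        ℤ.∣ ↥ X ℤ.* (+ b ℤ.* + 1) ∣
          ≡⟨ cong ℤ.∣_∣ (↥-/-sub (+ a) b {{s≢0 n}} ℚ.0ℚ) ⟩
        ℤ.∣ (+ a ℤ.* + 1 ℤ.- + 0 ℤ.* + b) ℤ.* ↧ X ∣
          ≡⟨ cong (λ t → ℤ.∣ t ℤ.* ↧ X ∣) (e (+ a) (+ b)) ⟩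
        ℤ.∣ + a ℤ.* ↧ X ∣
          ≡⟨ ℤ.abs-* (+ a) (↧ X) ⟩
        a * ↧ₙ X ∎
        where
          open ≡-Reasoning
          e : ∀ a b → a ℤ.* + 1 ℤ.- + 0 ℤ.* b ≡ a
          e = ℤ-solve-∀

odd-prime : ∀ {p} → Prime p → p ≢ 2 → ∃ λ ι → p ≡ 1 + 2 * ι
odd-prime {p} prime[p] p≢2 with p % 2 | m≡m%n+[m/n]*n p 2 | m%n<n p 2
... | 0 | p≡[p/2]*2 | _ =
  ⊥-elim ([ (λ ()) , p≢2 ∘ sym ]′ (prime⇒irreducible prime[p] (divides (p / 2) p≡[p/2]*2)))
... | 1 | p≡1+[p/2]*2 | _ = p / 2 , trans p≡1+[p/2]*2 (cong suc (ℕ.*-comm (p / 2) 2))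
... | suc (suc _) | _ | s≤s (s≤s ())

odd-^ : ∀ ι K → ∃ λ h → (1 + 2 * ι) ^ K ≡ 1 + 2 * h
odd-^ ι zero    = 0 , refl
odd-^ ι (suc K) with h , pᴷ≡1+2h ← odd-^ ι K =
  ι + h + 2 * ι * h , trans (cong ((1 + 2 * ι) *_) pᴷ≡1+2h) (e ι h)
  where e : ∀ ι h → (1 + 2 * ι) * (1 + 2 * h) ≡ 1 + 2 * (ι + h + 2 * ι * h)
        e = ℕ-solve-∀

fib-dense : ∀ p → Prime p → DenseInQp p inRF
fib-dense p prime[p] = cover⇒dense prime[p] fib fib-nz λ K → fib-cover (p ^ K) {{pᴷ≢0 K}}
  where pᴷ≢0 : ∀ K → NonZero (p ^ K)
        pᴷ≢0 K = ℕ.m^n≢0 p K {{prime⇒nonZero prime[p]}}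

lucas-dense : ∀ {p} → Prime p → p ≢ 2 → ∃ (λ n → p ∣ lucas (suc n)) → DenseInQp p inRL
lucas-dense prime[p] p≢2 (s , p∣L[s]) with ι , refl ← odd-prime prime[p] p≢2 =
  cover⇒dense prime[p] lucas lucas-nz cover
  where
    cover : ∀ K → CofactorsCover lucas ((1 + 2 * ι) ^ K)
    cover K with h , pᴷ≡1+2h ← odd-^ ι K | m′ , pᴷ⁺¹∣L[m] ← odd-power∣lucas ι s p∣L[s] K =
      subst (CofactorsCover lucas) (sym pᴷ≡1+2h)
        (lucas-cover h m′ (subst (_∣ lucas (suc m′)) pᴷ≡1+2h
                                 (∣-trans (n∣m*n (1 + 2 * ι)) pᴷ⁺¹∣L[m])))

lucas-dense⇒p≢2 : ∀ {p} → Prime p → DenseInQp p inRL → p ≢ 2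
lucas-dense⇒p≢2 prime[p] dense refl
  with m , 8∣L ← dense⇒p^k∣term prime[p] lucas lucas-nz dense 3 = 8∤lucas (suc m) 8∣L

lucas-dense⇒p∣lucas : ∀ {p} → Prime p → DenseInQp p inRL → ∃ λ n → p ∣ lucas (suc n)
lucas-dense⇒p∣lucas {p} prime[p] dense
  with m , p¹∣L ← dense⇒p^k∣term prime[p] lucas lucas-nz dense 1 =
  m , subst (_∣ lucas (suc m)) (ℕ.*-identityʳ p) p¹∣L

corollary5p3 : (∀ (p : ℕ) → Prime p → DenseInQp p inRF)
                 × (∀ (p : ℕ) → Prime p →
                      (DenseInQp p inRL ⇔ ((p ≢ 2) × ∃ (λ n → p ∣ lucas (suc n)))))
corollary5p3 = fib-dense , λ p prime[p] →
  mk⇔ (λ dense → lucas-dense⇒p≢2 prime[p] dense , lucas-dense⇒p∣lucas prime[p] dense)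
      (uncurry (lucas-dense prime[p]))
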